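{- Let $D=(V,A)$ be a digraph, $s\in V$, $k$ a positive integer, and for every $v\in V-s$ let $M_v=(\delta^{in}_D(v),r_v)$ be a matroid with $r_v(\delta^{in}_D(v))=k$. Assume that $r^\oplus(\delta^{in}_D(X))\ge k$ for every nonempty $X\subseteq V-s$. Then the set function $p:2^{\delta^{out}_D(s)}\to\mathbb{R}$, \[p(E)=\max\{k-r^\oplus(\delta^{in}_{D-E}(X)):\ \emptyset\ne X\subseteq V-s\},\] is near supermodular.
   Context: $\delta^{in}_H(X)$ is the set of arcs of digraph $H$ with head in $X$ and tail outside $X$; $\delta^{out}_D(s)$ is the set of arcs leaving $s$; $D-E$ is $D$ with the arcs of $E$ deleted. $r^\oplus(F)=\sum_{v\in V-s}r_v(F\cap\delta^{in}_D(v))$. For a set function $p$ on $2^S$, a set $X\subseteq S$ is separable if there is a partition $X_1,\dots,X_t$ of $X$ with $p(X)\le\sum_i p(X_i)$; $p$ is near supermodular if $p(X)+p(Y)\le p(X\cap Y)+p(X\cup Y)$ for every pair of non-separable sets $X,Y$ with $X\cap Y\ne\emptyset$. -}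

module Defs where

open import Data.Nat as ℕ using (ℕ; zero; suc)
open import Data.Integer as ℤ using (ℤ; +_; _-_; _⊔_)
open import Data.Bool using (Bool; true; false; _∧_; _∨_; not)
open import Data.Fin using (Fin; _≟_)
open import Data.Fin.Subset using (Subset; _⊆_; _∩_; _∪_; ∣_∣; ⁅_⁆; Nonempty; Empty; ⊥)
open import Data.Vec using (Vec; []; _∷_; tabulate; lookup)
import Data.Vec as Vec
open import Data.List using (List; []; _∷_; map; filter; length; foldr; allFin; _++_)
open import Data.Nat.ListAction using (sum)
open import Data.List.Relation.Unary.All using (All)
open import Data.List.Relation.Unary.AllPairs using (AllPairs)
open import Data.Product using (Σ; _×_)
open import Relation.Nullary using (¬_)
open import Relation.Nullary.Decidable using (⌊_⌋)
open import Relation.Binary.PropositionalEquality using (_≡_)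

-- A digraph D = (V, A) with V = Fin n and A = Fin m (parallel arcs allowed);
-- arc a goes from  tl a  to  hd a.
record Digraph (n m : ℕ) : Set where
  field
    tl : Fin m → Fin n
    hd : Fin m → Fin n
open Digraph public

δin : ∀ {n m} → Digraph n m → Subset m → Subset n → Subset m
δin D E X = tabulate λ a → lookup X (hd D a) ∧ not (lookup X (tl D a)) ∧ not (lookup E a)

δinV : ∀ {n m} → Digraph n m → Fin n → Subset m
δinV D v = δin D ⊥ ⁅ v ⁆

δout : ∀ {n m} → Digraph n m → Fin n → Subset m
δout D s = tabulate λ a → ⌊ tl D a ≟ s ⌋ ∧ not ⌊ hd D a ≟ s ⌋

-- Matroid on ground set G ⊆ A given by its rank function (rank axioms
-- required on subsets of G only; values outside 2^G are irrelevant).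
record IsMatroidRank {m : ℕ} (G : Subset m) (r : Subset m → ℕ) : Set where
  field
    bounded    : ∀ X → X ⊆ G → r X ℕ.≤ ∣ X ∣
    monotone   : ∀ X Y → X ⊆ Y → Y ⊆ G → r X ℕ.≤ r Y
    submodular : ∀ X Y → X ⊆ G → Y ⊆ G → r (X ∩ Y) ℕ.+ r (X ∪ Y) ℕ.≤ r X ℕ.+ r Y

rSum : ∀ {n m} → Digraph n m → Fin n → (Fin n → Subset m → ℕ) → Subset m → ℕ
rSum {n} D s r F = sum (map term (allFin n))
  where
  term : Fin n → ℕ
  term v with v ≟ s
  ... | Relation.Nullary.yes _ = 0
  ... | Relation.Nullary.no  _ = r v (F ∩ δinV D v)

allSubsets : (n : ℕ) → List (Subset n)
allSubsets zero    = [] ∷ []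
allSubsets (suc n) = map (true ∷_) (allSubsets n) ++ map (false ∷_) (allSubsets n)

isNonempty : ∀ {n} → Subset n → Bool
isNonempty X = Vec.foldr _ _∨_ false X

candidates : (n : ℕ) → Fin n → List (Subset n)
candidates n s = filter (λ X → Data.Bool._≟_ (isNonempty X ∧ not (lookup X s)) true) (allSubsets n)
  where import Data.Bool

-- maximum of a list of integers (the empty case never arises below)
maxℤ : List ℤ → ℤ
maxℤ []       = + 0
maxℤ (x ∷ xs) = foldr _⊔_ x xs

pFun : ∀ {n m} → Digraph n m → Fin n → (Fin n → Subset m → ℕ) → ℕ → Subset m → ℤ
pFun {n} D s r k E = maxℤ (map (λ X → + k - + rSum D s r (δin D E X)) (candidates n s))

Separable : ∀ {m} → (Subset m → ℤ) → Subset m → Set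
Separable {m} p X =
  Σ (List (Subset m)) λ parts →
    (2 ℕ.≤ length parts) × All Nonempty parts ×
    AllPairs (λ A B → Empty (A ∩ B)) parts ×
    (foldr _∪_ ⊥ parts ≡ X) ×
    (p X ℤ.≤ sum' (map p parts))
  where
  sum' : List ℤ → ℤ
  sum' = foldr ℤ._+_ (+ 0)

NearSupermodular : ∀ {m} → Subset m → (Subset m → ℤ) → Set
NearSupermodular S p =
  ∀ X Y → X ⊆ S → Y ⊆ S → ¬ Separable p X → ¬ Separable p Y → Nonempty (X ∩ Y) →
  p X ℤ.+ p Y ℤ.≤ p (X ∩ Y) ℤ.+ p (X ∪ Y)

module Submission where

-- Write value(E, Z) =
-- k − r^⊕(δ^in_{D−E}(Z)) for a candidate Z (nonempty, s ∉ Z), so p(E) is the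
-- maximum of value(E, ·).  Take non-separable X, Y ⊆ δ^out(s), an arc
-- c ∈ X ∩ Y and maximisers Z₁ of p(X), Z₂ of p(Y).  If the head of c is not
-- in Z₁, deleting c from X leaves value(X, Z₁) unchanged; as p ≥ 0 (witness
-- {v₀}, using r_{v₀}(δ^in(v₀)) = k), X would split into X − c and {c} unless
-- X = {c} ⊆ Y, in which case the inequality is an identity; likewise for Z₂.
-- Otherwise Z₁ ∩ Z₂, Z₁ ∪ Z₂ are candidates and bisubmodularity of
-- (E, Z) ↦ r^⊕(δ^in_{D−E}(Z)), proved vertex by vertex from the matroid rank
-- axioms and summed, yields p(X) + p(Y) ≤ p(X ∩ Y) + p(X ∪ Y).

open import Defs
open import Data.Nat as Nat using (ℕ; _≤_; _≥_; _+_; z≤n; s≤s)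
open import Data.Nat.Properties as ℕ using (+-0-commutativeMonoid; module ≤-Reasoning)
open import Data.Nat.ListAction using (sum)
open import Data.Integer as ℤ using (ℤ; +_; +≤+; 0ℤ)
import Data.Integer.Properties as ℤP
import Data.Integer.Solver as ℤSolver
open import Data.Bool using (true; false; _∧_; _∨_; not)
import Data.Bool as Bool
open import Data.Bool.Properties using (¬-not; ∨-zeroʳ; not-injective)
open import Data.Fin using (Fin; zero; suc; _≟_)
open import Data.Fin.Properties using (punchInᵢ≢i)
open import Data.Fin.Subset using (Subset; _∈_; _∉_; _⊆_; _∩_; _∪_; _─_; _-_; ⁅_⁆; ⊥; ∣_∣; Nonempty; Empty)
open import Data.Fin.Subset.Properties
  using (_∈?_; x∈⁅x⁆; x∈⁅y⁆⇒x≡y; ∉⊥; ⊆-antisym; ⊆-trans; p∩q⊆p; p∩q⊆q; x∈p∩q⁺; x∈p∩q⁻;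
         p⊆p∪q; q⊆p∪q; x∈p∪q⁺; x∈p∪q⁻; p─q⊆p; x∈p∧x≢y⇒x∈p-y; Empty-unique; ∣⊥∣≡0; ∩-comm; ∪-comm)
open import Data.Vec using ([]; _∷_; lookup; here; there)
open import Data.Vec.Properties using ([]=⇒lookup; lookup⇒[]=; lookup∘tabulate)
open import Data.Vec.Functional using (removeAt)
open import Data.List using ([]; _∷_; map; allFin; tabulate; foldr)
open import Data.List.Properties using (map-tabulate; map-cong)
open import Data.List.Relation.Unary.Any using (here; there)
open import Data.List.Relation.Unary.All using ([]; _∷_)
open import Data.List.Relation.Unary.AllPairs using ([]; _∷_)
open import Data.List.Membership.Propositional using () renaming (_∈_ to _∈ᴸ_)
open import Data.List.Membership.Propositional.Properties
  using (∈-map⁺; ∈-map⁻; ∈-++⁺ˡ; ∈-++⁺ʳ; ∈-filter⁺; ∈-filter⁻)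
open import Algebra.Properties.CommutativeMonoid.Sum +-0-commutativeMonoid
  using (∑-distrib-+; sum-cong-≗; sum-remove; sum-replicate-zero) renaming (sum to ∑)
open import Data.Product using (∃; _×_; _,_; proj₁; proj₂)
open import Data.Sum using (_⊎_; inj₁; inj₂; [_,_])
open import Function using (_∘_; id)
open import Relation.Binary.PropositionalEquality
  using (_≡_; _≢_; refl; sym; trans; cong; cong₂; subst; module ≡-Reasoning)
open import Relation.Nullary using (Dec; yes; no; ¬_; contradiction)
open import Relation.Nullary.Decidable using (⌊_⌋)

∈⇒lookup : ∀ {n} {p : Subset n} {x} → x ∈ p → lookup p x ≡ true
∈⇒lookup = []=⇒lookup

lookup⇒∈ : ∀ {n} {p : Subset n} {x} → lookup p x ≡ true → x ∈ p
lookup⇒∈ {p = p} {x} = lookup⇒[]= x p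

∉⇒lookup : ∀ {n} {p : Subset n} {x} → x ∉ p → lookup p x ≡ false
∉⇒lookup x∉p = ¬-not (x∉p ∘ lookup⇒∈)

lookup⇒∉ : ∀ {n} {p : Subset n} {x} → lookup p x ≡ false → x ∉ p
lookup⇒∉ eq x∈p with trans (sym (∈⇒lookup x∈p)) eq
... | ()

∧-true⁻ : ∀ {x y} → x ∧ y ≡ true → x ≡ true × y ≡ true
∧-true⁻ {true} {true} _ = refl , refl

enters⁻ : ∀ {h t e} → h ∧ not t ∧ not e ≡ true → h ≡ true × t ≡ false × e ≡ false
enters⁻ {true} {false} {false} _ = refl , refl , refl

enters⁺ : ∀ {h t e} → h ≡ true → t ≡ false → e ≡ false → h ∧ not t ∧ not e ≡ true
enters⁺ refl refl refl = refl

x∈p─q⇒x∉q : ∀ {n} {x : Fin n} (p q : Subset n) → x ∈ p ─ q → x ∉ q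
x∈p─q⇒x∉q (_ ∷ p) (_ ∷ q) (there x∈p─q) (there x∈q) = x∈p─q⇒x∉q p q x∈p─q x∈q

⁅⁆⊆ : ∀ {n} {x : Fin n} {p} → x ∈ p → ⁅ x ⁆ ⊆ p
⁅⁆⊆ {x = x} {p} x∈p y∈⁅x⁆ = subst (_∈ p) (sym (x∈⁅y⁆⇒x≡y x y∈⁅x⁆)) x∈p

⊆⇒∩≡ : ∀ {n} {p q : Subset n} → p ⊆ q → p ∩ q ≡ p
⊆⇒∩≡ {p = p} {q} p⊆q = ⊆-antisym (p∩q⊆p p q) (λ x∈p → x∈p∩q⁺ (x∈p , p⊆q x∈p))

∪-least : ∀ {n} {p q r : Subset n} → p ⊆ r → q ⊆ r → p ∪ q ⊆ r
∪-least {p = p} {q} p⊆r q⊆r x∈p∪q = [ p⊆r , q⊆r ] (x∈p∪q⁻ p q x∈p∪q)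

⊆⇒∪≡ : ∀ {n} {p q : Subset n} → p ⊆ q → p ∪ q ≡ q
⊆⇒∪≡ {p = p} {q} p⊆q = ⊆-antisym (∪-least p⊆q (λ x∈q → x∈q)) (q⊆p∪q p q)

lookup-δin : ∀ {n m} (D : Digraph n m) E Z a →
  lookup (δin D E Z) a ≡ (lookup Z (hd D a) ∧ not (lookup Z (tl D a)) ∧ not (lookup E a))
lookup-δin D E Z a = lookup∘tabulate _ a

lookup-δout : ∀ {n m} (D : Digraph n m) s a →
  lookup (δout D s) a ≡ (⌊ tl D a ≟ s ⌋ ∧ not ⌊ hd D a ≟ s ⌋)
lookup-δout D s a = lookup∘tabulate _ a

∈δin⁻ : ∀ {n m} (D : Digraph n m) E Z {a} → a ∈ δin D E Z → hd D a ∈ Z × tl D a ∉ Z × a ∉ E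
∈δin⁻ D E Z {a} a∈ with enters⁻ (trans (sym (lookup-δin D E Z a)) (∈⇒lookup a∈))
... | h , t , e = lookup⇒∈ h , lookup⇒∉ t , lookup⇒∉ e

∈δin⁺ : ∀ {n m} {D : Digraph n m} {E Z a} → hd D a ∈ Z → tl D a ∉ Z → a ∉ E → a ∈ δin D E Z
∈δin⁺ {D = D} {E} {Z} {a} h∈ t∉ a∉ =
  lookup⇒∈ (trans (lookup-δin D E Z a) (enters⁺ (∈⇒lookup h∈) (∉⇒lookup t∉) (∉⇒lookup a∉)))

δinV-hd : ∀ {n m} {D : Digraph n m} {v a} → a ∈ δinV D v → hd D a ≡ v
δinV-hd {D = D} {v} a∈ with ∈δin⁻ D ⊥ ⁅ v ⁆ a∈
... | h∈ , _ = x∈⁅y⁆⇒x≡y v h∈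

δout-tl : ∀ {n m} (D : Digraph n m) s {a} → a ∈ δout D s → tl D a ≡ s
δout-tl D s {a} a∈ with tl D a ≟ s | trans (sym (lookup-δout D s a)) (∈⇒lookup a∈)
... | yes tl≡s | _ = tl≡s
... | no _ | ()

δin-∩⊆∪ : ∀ {n m} (D : Digraph n m) X Y Z₁ Z₂ →
          (∀ {a} → a ∈ X → tl D a ∉ Z₂) → (∀ {a} → a ∈ Y → tl D a ∉ Z₁) →
          δin D (X ∩ Y) (Z₁ ∩ Z₂) ⊆ δin D X Z₁ ∪ δin D Y Z₂
δin-∩⊆∪ D X Y Z₁ Z₂ X-avoids Y-avoids {a} a∈
  with ∈δin⁻ D (X ∩ Y) (Z₁ ∩ Z₂) a∈
... | h∈ , t∉ , a∉ with x∈p∩q⁻ Z₁ Z₂ h∈ | a ∈? X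
...   | h∈Z₁ , h∈Z₂ | yes a∈X =
  x∈p∪q⁺ (inj₂ (∈δin⁺ h∈Z₂ (X-avoids a∈X) (λ a∈Y → a∉ (x∈p∩q⁺ (a∈X , a∈Y)))))
...   | h∈Z₁ , h∈Z₂ | no a∉X with tl D a ∈? Z₁
...     | no t∉Z₁ = x∈p∪q⁺ (inj₁ (∈δin⁺ h∈Z₁ t∉Z₁ a∉X))
...     | yes t∈Z₁ =
  x∈p∪q⁺ (inj₂ (∈δin⁺ h∈Z₂ (λ t∈Z₂ → t∉ (x∈p∩q⁺ (t∈Z₁ , t∈Z₂))) (λ a∈Y → Y-avoids a∈Y t∈Z₁)))

δin-∪⊆ˡ : ∀ {n m} (D : Digraph n m) X Y Z₁ Z₂ {a} →
          a ∈ δin D (X ∪ Y) (Z₁ ∪ Z₂) → hd D a ∈ Z₁ → a ∈ δin D X Z₁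
δin-∪⊆ˡ D X Y Z₁ Z₂ a∈ h∈ with ∈δin⁻ D (X ∪ Y) (Z₁ ∪ Z₂) a∈
... | _ , t∉ , a∉ = ∈δin⁺ h∈ (t∉ ∘ p⊆p∪q Z₂) (a∉ ∘ p⊆p∪q Y)

δin-∪⊆ʳ : ∀ {n m} (D : Digraph n m) X Y Z₁ Z₂ {a} →
          a ∈ δin D (X ∪ Y) (Z₁ ∪ Z₂) → hd D a ∈ Z₂ → a ∈ δin D Y Z₂
δin-∪⊆ʳ D X Y Z₁ Z₂ a∈ h∈ with ∈δin⁻ D (X ∪ Y) (Z₁ ∪ Z₂) a∈
... | _ , t∉ , a∉ = ∈δin⁺ h∈ (t∉ ∘ q⊆p∪q Z₁ Z₂) (a∉ ∘ q⊆p∪q X Y)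

δin-remove : ∀ {n m} (D : Digraph n m) E Z c → hd D c ∉ Z → δin D (E - c) Z ≡ δin D E Z
δin-remove D E Z c hc∉ = ⊆-antisym keep shrink
  where
  keep : δin D (E - c) Z ⊆ δin D E Z
  keep {a} a∈ with ∈δin⁻ D (E - c) Z a∈
  ... | h∈ , t∉ , a∉ = ∈δin⁺ h∈ t∉ a∉E
    where
    a∉E : a ∉ E
    a∉E a∈E with a ≟ c
    ... | yes refl = hc∉ h∈
    ... | no a≢c = a∉ (x∈p∧x≢y⇒x∈p-y a∈E a≢c)
  shrink : δin D E Z ⊆ δin D (E - c) Z
  shrink a∈ with ∈δin⁻ D E Z a∈
  ... | h∈ , t∉ , a∉ = ∈δin⁺ h∈ t∉ (a∉ ∘ p─q⊆p E ⁅ c ⁆)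

module _ {m} {G : Subset m} {ρ : Subset m → ℕ} (M : IsMatroidRank G ρ) where
  open IsMatroidRank M
  open ≤-Reasoning

  rank-empty : ∀ {S} → S ⊆ G → Empty S → ρ S ≡ 0
  rank-empty {S} S⊆G S-empty = ℕ.n≤0⇒n≡0 (begin
    ρ S        ≤⟨ bounded S S⊆G ⟩
    ∣ S ∣      ≡⟨ cong ∣_∣ (Empty-unique S-empty) ⟩
    ∣ ⊥ {m} ∣  ≡⟨ ∣⊥∣≡0 m ⟩
    0          ∎)

  rank-cover : ∀ {A B P Q} → A ⊆ G → B ⊆ G → P ⊆ A ∪ B → Q ⊆ A → Q ⊆ B →
               ρ P + ρ Q ≤ ρ A + ρ B
  rank-cover {A} {B} {P} {Q} A⊆G B⊆G P⊆A∪B Q⊆A Q⊆B = begin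
    ρ P + ρ Q               ≤⟨ ℕ.+-mono-≤ (monotone P (A ∪ B) P⊆A∪B A∪B⊆G)
                                             (monotone Q (A ∩ B) Q⊆A∩B A∩B⊆G) ⟩
    ρ (A ∪ B) + ρ (A ∩ B)   ≡⟨ ℕ.+-comm (ρ (A ∪ B)) (ρ (A ∩ B)) ⟩
    ρ (A ∩ B) + ρ (A ∪ B)   ≤⟨ submodular A B A⊆G B⊆G ⟩
    ρ A + ρ B               ∎
    where
    A∪B⊆G : A ∪ B ⊆ G
    A∪B⊆G = ∪-least A⊆G B⊆G
    A∩B⊆G : A ∩ B ⊆ G
    A∩B⊆G = ⊆-trans (p∩q⊆p A B) A⊆G
    Q⊆A∩B : Q ⊆ A ∩ B
    Q⊆A∩B x∈Q = x∈p∩q⁺ (Q⊆A x∈Q , Q⊆B x∈Q)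

-- All arcs of G have head v, so the case split is on whether v ∈ Z₁, Z₂.
module _ {n m} (D : Digraph n m) (v : Fin n) {ρ : Subset m → ℕ}
         (M : IsMatroidRank (δinV D v) ρ) (X Y : Subset m) (Z₁ Z₂ : Subset n)
         (X-avoids : ∀ {a} → a ∈ X → tl D a ∉ Z₂) (Y-avoids : ∀ {a} → a ∈ Y → tl D a ∉ Z₁) where
  open IsMatroidRank M using (monotone)
  open ≤-Reasoning

  private
    G P Q A B : Subset m
    G = δinV D v
    P = δin D (X ∩ Y) (Z₁ ∩ Z₂) ∩ G
    Q = δin D (X ∪ Y) (Z₁ ∪ Z₂) ∩ G
    A = δin D X Z₁ ∩ G
    B = δin D Y Z₂ ∩ G

    ⊆G : ∀ S → S ∩ G ⊆ G
    ⊆G S = p∩q⊆q S G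

    P⊆A∪B : P ⊆ A ∪ B
    P⊆A∪B a∈P with x∈p∩q⁻ _ G a∈P
    ... | a∈ , a∈G with x∈p∪q⁻ (δin D X Z₁) (δin D Y Z₂) (δin-∩⊆∪ D X Y Z₁ Z₂ X-avoids Y-avoids a∈)
    ...   | inj₁ a∈A = x∈p∪q⁺ (inj₁ (x∈p∩q⁺ (a∈A , a∈G)))
    ...   | inj₂ a∈B = x∈p∪q⁺ (inj₂ (x∈p∩q⁺ (a∈B , a∈G)))

    Q⊆A : v ∈ Z₁ → Q ⊆ A
    Q⊆A v∈Z₁ a∈Q with x∈p∩q⁻ _ G a∈Q
    ... | a∈ , a∈G = x∈p∩q⁺ (δin-∪⊆ˡ D X Y Z₁ Z₂ a∈ (subst (_∈ Z₁) (sym (δinV-hd a∈G)) v∈Z₁) , a∈G)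

    Q⊆B : v ∈ Z₂ → Q ⊆ B
    Q⊆B v∈Z₂ a∈Q with x∈p∩q⁻ _ G a∈Q
    ... | a∈ , a∈G = x∈p∩q⁺ (δin-∪⊆ʳ D X Y Z₁ Z₂ a∈ (subst (_∈ Z₂) (sym (δinV-hd a∈G)) v∈Z₂) , a∈G)

    -- Arcs of P have their head in Z₁ ∩ Z₂, arcs of Q in Z₁ ∪ Z₂.
    P-empty : ¬ (v ∈ Z₁ × v ∈ Z₂) → Empty P
    P-empty v∉ (a , a∈P) with x∈p∩q⁻ _ G a∈P
    ... | a∈ , a∈G with ∈δin⁻ D (X ∩ Y) (Z₁ ∩ Z₂) a∈
    ...   | h∈ , _ = v∉ (x∈p∩q⁻ Z₁ Z₂ (subst (_∈ Z₁ ∩ Z₂) (δinV-hd a∈G) h∈))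

    Q-empty : v ∉ Z₁ → v ∉ Z₂ → Empty Q
    Q-empty v∉Z₁ v∉Z₂ (a , a∈Q) with x∈p∩q⁻ _ G a∈Q
    ... | a∈ , a∈G with ∈δin⁻ D (X ∪ Y) (Z₁ ∪ Z₂) a∈
    ...   | h∈ , _ = [ v∉Z₁ , v∉Z₂ ] (x∈p∪q⁻ Z₁ Z₂ (subst (_∈ Z₁ ∪ Z₂) (δinV-hd a∈G) h∈))

    with-P-empty : ¬ (v ∈ Z₁ × v ∈ Z₂) → ρ Q ≤ ρ A + ρ B → ρ P + ρ Q ≤ ρ A + ρ B
    with-P-empty v∉ ρQ≤ = subst (λ x → x + ρ Q ≤ ρ A + ρ B)
                                (sym (rank-empty M (⊆G _) (P-empty v∉))) ρQ≤

  vertex-bisubmodular : ρ P + ρ Q ≤ ρ A + ρ B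
  vertex-bisubmodular with v ∈? Z₁ | v ∈? Z₂
  ... | yes v∈Z₁ | yes v∈Z₂ = rank-cover M (⊆G _) (⊆G _) P⊆A∪B (Q⊆A v∈Z₁) (Q⊆B v∈Z₂)
  ... | yes v∈Z₁ | no v∉Z₂ = with-P-empty (v∉Z₂ ∘ proj₂) (begin
    ρ Q          ≤⟨ monotone Q A (Q⊆A v∈Z₁) (⊆G _) ⟩
    ρ A          ≤⟨ ℕ.m≤m+n (ρ A) (ρ B) ⟩
    ρ A + ρ B    ∎)
  ... | no v∉Z₁ | yes v∈Z₂ = with-P-empty (v∉Z₁ ∘ proj₁) (begin
    ρ Q          ≤⟨ monotone Q B (Q⊆B v∈Z₂) (⊆G _) ⟩
    ρ B          ≤⟨ ℕ.m≤n+m (ρ B) (ρ A) ⟩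
    ρ A + ρ B    ∎)
  ... | no v∉Z₁ | no v∉Z₂ = with-P-empty (v∉Z₁ ∘ proj₁) (begin
    ρ Q          ≡⟨ rank-empty M (⊆G _) (Q-empty v∉Z₁ v∉Z₂) ⟩
    0            ≤⟨ z≤n ⟩
    ρ A + ρ B    ∎)

∑-mono : ∀ {n} {f g : Fin n → ℕ} → (∀ i → f i ≤ g i) → ∑ f ≤ ∑ g
∑-mono {Nat.zero}  _   = z≤n
∑-mono {Nat.suc n} f≤g = ℕ.+-mono-≤ (f≤g zero) (∑-mono (f≤g ∘ suc))

∑-concentrated : ∀ {n} (f : Fin n → ℕ) i → (∀ j → j ≢ i → f j ≡ 0) → ∑ f ≡ f i
∑-concentrated {Nat.suc n} f i vanish = begin
  ∑ f                        ≡⟨ sum-remove f ⟩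
  f i + ∑ (removeAt f i)     ≡⟨ cong (λ x → f i + x) rest≡0 ⟩
  f i + 0                    ≡⟨ ℕ.+-identityʳ (f i) ⟩
  f i                        ∎
  where
  open ≡-Reasoning
  rest≡0 : ∑ (removeAt f i) ≡ 0
  rest≡0 = trans (sum-cong-≗ (λ j → vanish _ (punchInᵢ≢i i j))) (sum-replicate-zero n)

sum-allFin : ∀ {n} (f : Fin n → ℕ) → sum (map f (allFin n)) ≡ ∑ f
sum-allFin {n} f = trans (cong sum (map-tabulate id f)) (sum-tabulate f)
  where
  sum-tabulate : ∀ {k} (g : Fin k → ℕ) → sum (tabulate g) ≡ ∑ g
  sum-tabulate {Nat.zero}  g = refl
  sum-tabulate {Nat.suc k} g = cong (λ x → g zero + x) (sum-tabulate (g ∘ suc))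

module AggregatedRank {n m} (D : Digraph n m) (s : Fin n) (r : Fin n → Subset m → ℕ)
         (matroids : ∀ v → v ≢ s → IsMatroidRank (δinV D v) (r v)) where

  vertexRank : Subset m → Fin n → ℕ
  vertexRank F v with v ≟ s
  ... | yes _ = 0
  ... | no _  = r v (F ∩ δinV D v)

  vertexRank-≢ : ∀ F {v} → v ≢ s → vertexRank F v ≡ r v (F ∩ δinV D v)
  vertexRank-≢ F {v} v≢s with v ≟ s
  ... | yes v≡s = contradiction v≡s v≢s
  ... | no _    = refl

  rSum-∑ : ∀ F → rSum D s r F ≡ ∑ (vertexRank F)
  rSum-∑ F = sums-agree
    where
    agree : ∀ v → _ ≡ vertexRank F v
    sums-agree : rSum D s r F ≡ ∑ (vertexRank F)
    sums-agree = trans (cong sum (map-cong agree (allFin n))) (sum-allFin (vertexRank F))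
    agree v with v ≟ s
    ... | yes _ = refl
    ... | no _  = refl

  rSum-bisubmodular : ∀ X Y Z₁ Z₂ →
    (∀ {a} → a ∈ X → tl D a ∉ Z₂) → (∀ {a} → a ∈ Y → tl D a ∉ Z₁) →
    rSum D s r (δin D (X ∩ Y) (Z₁ ∩ Z₂)) + rSum D s r (δin D (X ∪ Y) (Z₁ ∪ Z₂))
      ≤ rSum D s r (δin D X Z₁) + rSum D s r (δin D Y Z₂)
  rSum-bisubmodular X Y Z₁ Z₂ X-avoids Y-avoids = begin
    rSum D s r P + rSum D s r Q          ≡⟨ cong₂ _+_ (rSum-∑ P) (rSum-∑ Q) ⟩
    ∑ (vertexRank P) + ∑ (vertexRank Q)  ≡⟨ ∑-distrib-+ (vertexRank P) (vertexRank Q) ⟨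
    ∑ (λ v → vertexRank P v + vertexRank Q v)
                                         ≤⟨ ∑-mono at-vertex ⟩
    ∑ (λ v → vertexRank A v + vertexRank B v)
                                         ≡⟨ ∑-distrib-+ (vertexRank A) (vertexRank B) ⟩
    ∑ (vertexRank A) + ∑ (vertexRank B)  ≡⟨ cong₂ _+_ (rSum-∑ A) (rSum-∑ B) ⟨
    rSum D s r A + rSum D s r B          ∎
    where
    open ≤-Reasoning
    P Q A B : Subset m
    P = δin D (X ∩ Y) (Z₁ ∩ Z₂)
    Q = δin D (X ∪ Y) (Z₁ ∪ Z₂)
    A = δin D X Z₁
    B = δin D Y Z₂
    at-vertex : ∀ v → vertexRank P v + vertexRank Q v ≤ vertexRank A v + vertexRank B v
    at-vertex v with v ≟ s
    ... | yes _   = z≤n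
    ... | no v≢s  = vertex-bisubmodular D v (matroids v v≢s) X Y Z₁ Z₂ X-avoids Y-avoids

  -- Only δ^in(v) meets δ^in_{D−E}({v}), so r^⊕(δ^in_{D−E}({v})) ≤ r_v(δ^in(v)).
  rSum-singleton : ∀ E {v} → v ≢ s → rSum D s r (δin D E ⁅ v ⁆) ≤ r v (δinV D v)
  rSum-singleton E {v} v≢s = begin
    rSum D s r F         ≡⟨ rSum-∑ F ⟩
    ∑ (vertexRank F)     ≡⟨ ∑-concentrated (vertexRank F) v elsewhere ⟩
    vertexRank F v       ≡⟨ vertexRank-≢ F v≢s ⟩
    r v (F ∩ δinV D v)   ≤⟨ IsMatroidRank.monotone (matroids v v≢s) _ _ (p∩q⊆q F _) (λ a∈ → a∈) ⟩
    r v (δinV D v)       ∎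
    where
    open ≤-Reasoning
    F : Subset m
    F = δin D E ⁅ v ⁆
    elsewhere : ∀ w → w ≢ v → vertexRank F w ≡ 0
    elsewhere w w≢v with w ≟ s
    ... | yes _   = refl
    ... | no w≢s  = rank-empty (matroids w w≢s) (p∩q⊆q F _) no-arc
      where
      no-arc : Empty (F ∩ δinV D w)
      no-arc (a , a∈) with x∈p∩q⁻ F _ a∈
      ... | a∈F , a∈G = w≢v (trans (sym (δinV-hd a∈G)) (x∈⁅y⁆⇒x≡y v (proj₁ (∈δin⁻ D E ⁅ v ⁆ a∈F))))

maxℤ-upper : ∀ {x xs} → x ∈ᴸ xs → x ℤ.≤ maxℤ xs
maxℤ-upper {xs = y ∷ ys} = foldr-upper y ys
  where
  foldr-upper : ∀ y ys {x} → x ∈ᴸ y ∷ ys → x ℤ.≤ foldr ℤ._⊔_ y ys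
  foldr-upper y []       (here refl)         = ℤP.≤-refl
  foldr-upper y (z ∷ zs) (here refl)         = ℤP.≤-trans (foldr-upper y zs (here refl)) (ℤP.i≤j⊔i z _)
  foldr-upper y (z ∷ zs) (there (here refl)) = ℤP.i≤i⊔j z _
  foldr-upper y (z ∷ zs) (there (there x∈)) = ℤP.≤-trans (foldr-upper y zs (there x∈)) (ℤP.i≤j⊔i z _)

maxℤ-attained : ∀ {x xs} → x ∈ᴸ xs → maxℤ xs ∈ᴸ xs
maxℤ-attained {xs = y ∷ ys} _ = foldr-attained y ys
  where
  skip : ∀ {w y z zs} → w ∈ᴸ y ∷ zs → w ∈ᴸ y ∷ z ∷ zs
  skip (here w≡y) = here w≡y
  skip (there w∈) = there (there w∈)
  foldr-attained : ∀ y ys → foldr ℤ._⊔_ y ys ∈ᴸ y ∷ ys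
  foldr-attained y []       = here refl
  foldr-attained y (z ∷ zs) with ℤP.⊔-sel z (foldr ℤ._⊔_ y zs)
  ... | inj₁ ⊔≡z    = there (here ⊔≡z)
  ... | inj₂ ⊔≡rest = subst (_∈ᴸ y ∷ z ∷ zs) (sym ⊔≡rest) (skip (foldr-attained y zs))

allSubsets-complete : ∀ {n} (X : Subset n) → X ∈ᴸ allSubsets n
allSubsets-complete []            = here refl
allSubsets-complete (true  ∷ X) = ∈-++⁺ˡ (∈-map⁺ (true ∷_) (allSubsets-complete X))
allSubsets-complete (false ∷ X) = ∈-++⁺ʳ (map (true ∷_) (allSubsets _)) (∈-map⁺ (false ∷_) (allSubsets-complete X))

isNonempty-complete : ∀ {n} {X : Subset n} {a} → a ∈ X → isNonempty X ≡ true
isNonempty-complete here                 = refl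
isNonempty-complete {X = x ∷ X} (there a∈X) = trans (cong (x ∨_) (isNonempty-complete a∈X)) (∨-zeroʳ x)

module _ {n} (s : Fin n) where
  private
    candidate? : (X : Subset n) → Dec ((isNonempty X ∧ not (lookup X s)) ≡ true)
    candidate? X = (isNonempty X ∧ not (lookup X s)) Bool.≟ true

  candidate⁺ : ∀ {Z a} → a ∈ Z → s ∉ Z → Z ∈ᴸ candidates n s
  candidate⁺ {Z} a∈Z s∉Z = ∈-filter⁺ candidate? (allSubsets-complete Z)
    (cong₂ (λ x y → x ∧ not y) (isNonempty-complete a∈Z) (∉⇒lookup s∉Z))

  candidate⁻ : ∀ {Z} → Z ∈ᴸ candidates n s → s ∉ Z
  candidate⁻ {Z} Z∈ with ∧-true⁻ {isNonempty Z} (proj₂ (∈-filter⁻ candidate? {xs = allSubsets n} Z∈))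
  ... | _ , not-s = lookup⇒∉ (not-injective not-s)

split-off : ∀ {m} (p : Subset m → ℤ) {X c} → c ∈ X → Nonempty (X - c) →
            p X ℤ.≤ p (X - c) ℤ.+ p ⁅ c ⁆ → Separable p X
split-off p {X} {c} c∈X rest-nonempty split-ineq =
  ((X - c) ∷ ⁅ c ⁆ ∷ []) , s≤s (s≤s z≤n) , (rest-nonempty ∷ (c , x∈⁅x⁆ c) ∷ []) ,
  ((disjoint ∷ []) ∷ [] ∷ []) , covers ,
  subst (λ x → p X ℤ.≤ p (X - c) ℤ.+ x) (sym (ℤP.+-identityʳ (p ⁅ c ⁆))) split-ineq
  where
  disjoint : Empty ((X - c) ∩ ⁅ c ⁆)
  disjoint (a , a∈) with x∈p∩q⁻ (X - c) ⁅ c ⁆ a∈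
  ... | a∈X-c , a∈⁅c⁆ = x∈p─q⇒x∉q X ⁅ c ⁆ a∈X-c a∈⁅c⁆
  c-part : ⁅ c ⁆ ∪ ⊥ ⊆ X
  c-part = ∪-least (⁅⁆⊆ c∈X) (λ a∈⊥ → contradiction a∈⊥ ∉⊥)
  covered : X ⊆ (X - c) ∪ (⁅ c ⁆ ∪ ⊥)
  covered {a} a∈X with a ≟ c
  ... | yes refl = x∈p∪q⁺ (inj₂ (x∈p∪q⁺ (inj₁ (x∈⁅x⁆ a))))
  ... | no a≢c   = x∈p∪q⁺ (inj₁ (x∈p∧x≢y⇒x∈p-y a∈X a≢c))
  covers : (X - c) ∪ (⁅ c ⁆ ∪ ⊥) ≡ X
  covers = ⊆-antisym (∪-least (p─q⊆p X ⁅ c ⁆) c-part) covered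

nested-supermodular : ∀ {m} (p : Subset m → ℤ) {X Y} → X ⊆ Y ⊎ Y ⊆ X →
                      p X ℤ.+ p Y ℤ.≤ p (X ∩ Y) ℤ.+ p (X ∪ Y)
nested-supermodular p {X} {Y} (inj₁ X⊆Y) =
  ℤP.≤-reflexive (sym (cong₂ (λ A B → p A ℤ.+ p B) (⊆⇒∩≡ X⊆Y) (⊆⇒∪≡ X⊆Y)))
nested-supermodular p {X} {Y} (inj₂ Y⊆X) =
  ℤP.≤-reflexive (trans (ℤP.+-comm (p X) (p Y))
    (sym (cong₂ (λ A B → p A ℤ.+ p B) (trans (∩-comm X Y) (⊆⇒∩≡ Y⊆X)) (trans (∪-comm X Y) (⊆⇒∪≡ Y⊆X)))))

deficits-mono : ∀ k a b c d → c + d ≤ a + b →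
  (+ k ℤ.- + a) ℤ.+ (+ k ℤ.- + b) ℤ.≤ (+ k ℤ.- + c) ℤ.+ (+ k ℤ.- + d)
deficits-mono k a b c d c+d≤a+b = begin
  (K ℤ.- + a) ℤ.+ (K ℤ.- + b)   ≡⟨ regroup (+ a) (+ b) ⟩
  2K ℤ.- (+ a ℤ.+ + b)           ≡⟨ cong (λ x → 2K ℤ.- x) (ℤP.pos-+ a b) ⟨
  2K ℤ.- + (a + b)               ≤⟨ ℤP.+-monoʳ-≤ 2K (ℤP.neg-mono-≤ (+≤+ c+d≤a+b)) ⟩
  2K ℤ.- + (c + d)               ≡⟨ cong (λ x → 2K ℤ.- x) (ℤP.pos-+ c d) ⟩
  2K ℤ.- (+ c ℤ.+ + d)           ≡⟨ regroup (+ c) (+ d) ⟨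
  (K ℤ.- + c) ℤ.+ (K ℤ.- + d)   ∎
  where
  open ℤP.≤-Reasoning
  K 2K : ℤ
  K = + k
  2K = K ℤ.+ K
  regroup : ∀ x y → (K ℤ.- x) ℤ.+ (K ℤ.- y) ≡ 2K ℤ.- (x ℤ.+ y)
  regroup = solve 3 (λ K x y → (K :- x) :+ (K :- y) := (K :+ K) :- (x :+ y)) refl K
    where open ℤSolver.+-*-Solver

module NearSupermodularity {n m} (D : Digraph n m) (s : Fin n) (k : ℕ) (r : Fin n → Subset m → ℕ)
         (v₀ : Fin n) (v₀≢s : v₀ ≢ s)
         (matroids : ∀ v → v ≢ s → IsMatroidRank (δinV D v) (r v))
         (rank-k : ∀ v → v ≢ s → r v (δinV D v) ≡ k) where
  open AggregatedRank D s r matroids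

  cut : Subset m → Subset n → ℕ
  cut E Z = rSum D s r (δin D E Z)

  value : Subset m → Subset n → ℤ
  value E Z = + k ℤ.- + cut E Z

  p : Subset m → ℤ
  p = pFun D s r k

  -- Every candidate bounds p from below; the maximum is attained since the
  -- candidate list contains {v₀}.
  p-upper : ∀ E {Z} → Z ∈ᴸ candidates n s → value E Z ℤ.≤ p E
  p-upper E Z∈ = maxℤ-upper (∈-map⁺ (value E) Z∈)

  v₀-candidate : ⁅ v₀ ⁆ ∈ᴸ candidates n s
  v₀-candidate = candidate⁺ s (x∈⁅x⁆ v₀) (v₀≢s ∘ sym ∘ x∈⁅y⁆⇒x≡y v₀)

  p-attained : ∀ E → ∃ λ Z → Z ∈ᴸ candidates n s × p E ≡ value E Z
  p-attained E = ∈-map⁻ (value E) (maxℤ-attained (∈-map⁺ (value E) v₀-candidate))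

  -- p ≥ 0, witnessed by {v₀}: r^⊕(δ^in_{D−E}({v₀})) ≤ r_{v₀}(δ^in(v₀)) = k.
  p-nonneg : ∀ E → 0ℤ ℤ.≤ p E
  p-nonneg E = ℤP.≤-trans (ℤP.i≤j⇒0≤j-i (+≤+ cut≤k)) (p-upper E v₀-candidate)
    where
    cut≤k : cut E ⁅ v₀ ⁆ ≤ k
    cut≤k = subst (cut E ⁅ v₀ ⁆ ≤_) (rank-k v₀ v₀≢s) (rSum-singleton E v₀≢s)

  -- If Z attains p X and c ∈ X does not enter Z, deleting c does not change
  -- value X Z, so p X ≤ p (X − c) ≤ p (X − c) + p {c}.  A non-separable X
  -- therefore has no element besides c.
  removal-claim : ∀ {X Z c} → ¬ Separable p X → c ∈ X → Z ∈ᴸ candidates n s →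
                  p X ≡ value X Z → hd D c ∉ Z → X ⊆ ⁅ c ⁆
  removal-claim {X} {Z} {c} nonsep c∈X Z∈ pX≡ hc∉Z {a} a∈X with a ≟ c
  ... | yes refl = x∈⁅x⁆ a
  ... | no a≢c   = contradiction (split-off p c∈X (a , x∈p∧x≢y⇒x∈p-y a∈X a≢c) split-ineq) nonsep
    where
    open ℤP.≤-Reasoning
    split-ineq : p X ℤ.≤ p (X - c) ℤ.+ p ⁅ c ⁆
    split-ineq = begin
      p X                           ≡⟨ pX≡ ⟩
      value X Z                     ≡⟨ cong (λ F → + k ℤ.- + rSum D s r F) (δin-remove D X Z c hc∉Z) ⟨
      value (X - c) Z               ≤⟨ p-upper (X - c) Z∈ ⟩
      p (X - c)                     ≡⟨ ℤP.+-identityʳ (p (X - c)) ⟨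
      p (X - c) ℤ.+ 0ℤ              ≤⟨ ℤP.+-monoʳ-≤ (p (X - c)) (p-nonneg ⁅ c ⁆) ⟩
      p (X - c) ℤ.+ p ⁅ c ⁆         ∎

  uncrossing : ∀ {X Y Z₁ Z₂ h} → X ⊆ δout D s → Y ⊆ δout D s →
               Z₁ ∈ᴸ candidates n s → Z₂ ∈ᴸ candidates n s → h ∈ Z₁ → h ∈ Z₂ →
               value X Z₁ ℤ.+ value Y Z₂ ℤ.≤ p (X ∩ Y) ℤ.+ p (X ∪ Y)
  uncrossing {X} {Y} {Z₁} {Z₂} X⊆ Y⊆ Z₁∈ Z₂∈ h∈Z₁ h∈Z₂ = begin
    value X Z₁ ℤ.+ value Y Z₂
      ≤⟨ deficits-mono k (cut X Z₁) (cut Y Z₂) (cut (X ∩ Y) (Z₁ ∩ Z₂)) (cut (X ∪ Y) (Z₁ ∪ Z₂))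
                       (rSum-bisubmodular X Y Z₁ Z₂ (avoids X⊆ s∉Z₂) (avoids Y⊆ s∉Z₁)) ⟩
    value (X ∩ Y) (Z₁ ∩ Z₂) ℤ.+ value (X ∪ Y) (Z₁ ∪ Z₂)
      ≤⟨ ℤP.+-mono-≤ (p-upper (X ∩ Y) ∩-candidate) (p-upper (X ∪ Y) ∪-candidate) ⟩
    p (X ∩ Y) ℤ.+ p (X ∪ Y) ∎
    where
    open ℤP.≤-Reasoning
    s∉Z₁ : s ∉ Z₁
    s∉Z₁ = candidate⁻ s Z₁∈
    s∉Z₂ : s ∉ Z₂
    s∉Z₂ = candidate⁻ s Z₂∈
    avoids : ∀ {W Z} → W ⊆ δout D s → s ∉ Z → ∀ {a} → a ∈ W → tl D a ∉ Z
    avoids W⊆ s∉Z a∈W = subst (_∉ _) (sym (δout-tl D s (W⊆ a∈W))) s∉Z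
    ∩-candidate : Z₁ ∩ Z₂ ∈ᴸ candidates n s
    ∩-candidate = candidate⁺ s (x∈p∩q⁺ (h∈Z₁ , h∈Z₂)) (s∉Z₁ ∘ proj₁ ∘ x∈p∩q⁻ Z₁ Z₂)
    ∪-candidate : Z₁ ∪ Z₂ ∈ᴸ candidates n s
    ∪-candidate = candidate⁺ s (x∈p∪q⁺ (inj₁ h∈Z₁)) ([ s∉Z₁ , s∉Z₂ ] ∘ x∈p∪q⁻ Z₁ Z₂)

  near-supermodular : NearSupermodular (δout D s) p
  near-supermodular X Y X⊆ Y⊆ nonsep-X nonsep-Y (c , c∈X∩Y)
    with x∈p∩q⁻ X Y c∈X∩Y | p-attained X | p-attained Y
  ... | c∈X , c∈Y | Z₁ , Z₁∈ , pX≡ | Z₂ , Z₂∈ , pY≡ with hd D c ∈? Z₁ | hd D c ∈? Z₂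
  ...   | no hc∉Z₁ | _ =
    nested-supermodular p (inj₁ (⊆-trans (removal-claim nonsep-X c∈X Z₁∈ pX≡ hc∉Z₁) (⁅⁆⊆ c∈Y)))
  ...   | yes _ | no hc∉Z₂ =
    nested-supermodular p (inj₂ (⊆-trans (removal-claim nonsep-Y c∈Y Z₂∈ pY≡ hc∉Z₂) (⁅⁆⊆ c∈X)))
  ...   | yes hc∈Z₁ | yes hc∈Z₂ = begin
    p X ℤ.+ p Y                  ≡⟨ cong₂ ℤ._+_ pX≡ pY≡ ⟩
    value X Z₁ ℤ.+ value Y Z₂    ≤⟨ uncrossing X⊆ Y⊆ Z₁∈ Z₂∈ hc∈Z₁ hc∈Z₂ ⟩
    p (X ∩ Y) ℤ.+ p (X ∪ Y)      ∎
    where open ℤP.≤-Reasoning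

theorem3p3 : ∀ {n m} (D : Digraph n m) (s : Fin n) (k : ℕ) (r : Fin n → Subset m → ℕ) →
    ∃ (λ v → v ≢ s) →
    1 ≤ k →
    (∀ v → v ≢ s → IsMatroidRank (δinV D v) (r v)) →
    (∀ v → v ≢ s → r v (δinV D v) ≡ k) →
    (∀ (X : Subset n) → Nonempty X → s ∉ X → rSum D s r (δin D ⊥ X) ≥ k) →
    NearSupermodular (δout D s) (pFun D s r k)
theorem3p3 D s k r (v₀ , v₀≢s) _ matroids rank-k _ =
  NearSupermodularity.near-supermodular D s k r v₀ v₀≢s matroids rank-k
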